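{- Let $j,k\geq1$ be integers with $k\geq j$. Every $(k,j)$-incompressible sequence $X\in2^\omega$ is complex, i.e., there is a computable, unbounded, non-decreasing function $f:\omega\to\omega$ with $K(X\upharpoonright n)\geq f(n)$ for all $n$.
   Context: $X\upharpoonright n$ is the first $n$ bits of $X$; $\#_0,\#_1$ count 0's and 1's; $\ell_k(\sigma)=\#_0(\sigma)+k\,\#_1(\sigma)$. Fix a computable listing $(M_e)$ of prefix-free machines and the universal prefix-free machine $U(0^e1\sigma)=M_e(\sigma)$. $K(\sigma)=\min\{|\tau|:U(\tau)\downarrow=\sigma\}$ is prefix-free Kolmogorov complexity and $K^{(k)}(\sigma)=\min\{\ell_k(\tau):U(\tau)\downarrow=\sigma\}$. $X$ is $(k,j)$-incompressible if there is $d$ with $K^{(k)}(X\upharpoonright n)\geq\ell_j(X\upharpoonright n)-d$ for all $n$. -}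

module Defs where

open import Data.Nat using (ℕ; zero; suc; _+_; _*_; _≤_)
open import Data.Bool using (Bool; true; false)
open import Data.Fin using (Fin)
open import Data.Vec using (Vec; []; _∷_; lookup)
open import Data.List using (List; []; _∷_; _++_; length; replicate; applyUpTo)
open import Data.Product using (Σ; ∃; ∃-syntax; _×_; _,_)
open import Relation.Binary.PropositionalEquality using (_≡_)
open import Function.Bundles using (_⇔_)

data Code : ℕ → Set where
  zer  : ∀ {n} → Code n
  succ : Code 1
  proj : ∀ {n} → Fin n → Code n
  comp : ∀ {n m} → Code m → Vec (Code n) m → Code n
  prec : ∀ {n} → Code n → Code (suc (suc n)) → Code (suc n)
  mu   : ∀ {n} → Code (suc n) → Code n

mutual
  data Eval : ∀ {n} → Code n → Vec ℕ n → ℕ → Set where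
    ev-zer  : ∀ {n} {xs : Vec ℕ n} → Eval zer xs 0
    ev-succ : ∀ {x} → Eval succ (x ∷ []) (suc x)
    ev-proj : ∀ {n} {i : Fin n} {xs} → Eval (proj i) xs (lookup xs i)
    ev-comp : ∀ {n m} {f : Code m} {gs : Vec (Code n) m} {xs ys v}
            → EvalAll gs xs ys → Eval f ys v → Eval (comp f gs) xs v
    ev-prec-z : ∀ {n} {b : Code n} {s} {xs v}
              → Eval b xs v → Eval (prec b s) (0 ∷ xs) v
    ev-prec-s : ∀ {n} {b : Code n} {s} {xs x r v}
              → Eval (prec b s) (x ∷ xs) r → Eval s (x ∷ r ∷ xs) v
              → Eval (prec b s) (suc x ∷ xs) v
    ev-mu   : ∀ {n} {f : Code (suc n)} {xs y}
            → MuSearch f xs 0 y → Eval (mu f) xs y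

  data EvalAll {n} : ∀ {m} → Vec (Code n) m → Vec ℕ n → Vec ℕ m → Set where
    ev-[] : ∀ {xs} → EvalAll [] xs []
    ev-∷  : ∀ {m} {g} {gs : Vec (Code n) m} {xs y ys}
          → Eval g xs y → EvalAll gs xs ys → EvalAll (g ∷ gs) xs (y ∷ ys)

  data MuSearch {n} (f : Code (suc n)) (xs : Vec ℕ n) : ℕ → ℕ → Set where
    found : ∀ {z} → Eval f (z ∷ xs) 0 → MuSearch f xs z z
    step  : ∀ {z w y} → Eval f (z ∷ xs) (suc w) → MuSearch f xs (suc z) y
          → MuSearch f xs z y

Computable : (ℕ → ℕ) → Set
Computable f = Σ (Code 1) λ c → ∀ n → Eval c (n ∷ []) (f n)

Str : Set
Str = List Bool

-- bijective coding of binary strings by natural numbers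
enc : Str → ℕ
enc []           = 0
enc (false ∷ σ)  = suc (2 * enc σ)
enc (true  ∷ σ)  = suc (suc (2 * enc σ))

-- a machine, as its halting relation:  R τ σ  means  R(τ)↓ = σ
Machine : Set₁
Machine = Str → Str → Set

MachineOf : Code 1 → Machine
MachineOf c τ σ = Eval c (enc τ ∷ []) (enc σ)

PrefixFree : Machine → Set
PrefixFree R = ∀ τ ρ σ σ' → R τ σ → R (τ ++ ρ) σ' → ρ ≡ []

-- a listing of machines given uniformly by a binary code:  M_e(τ) = L(e, τ)
ListedMachine : Code 2 → ℕ → Machine
ListedMachine L e τ σ = Eval L (e ∷ enc τ ∷ []) (enc σ)

IsPFListing : Code 2 → Set
IsPFListing L =
  (∀ e → PrefixFree (ListedMachine L e)) ×
  (∀ c → PrefixFree (MachineOf c) →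
     ∃[ e ] (∀ τ σ → ListedMachine L e τ σ ⇔ MachineOf c τ σ))

U : Code 2 → Machine
U L τ σ = ∃[ e ] ∃[ ρ ] (τ ≡ replicate e false ++ (true ∷ ρ) × ListedMachine L e ρ σ)

#0 : Str → ℕ
#0 []          = 0
#0 (false ∷ σ) = suc (#0 σ)
#0 (true ∷ σ)  = #0 σ

#1 : Str → ℕ
#1 []          = 0
#1 (false ∷ σ) = #1 σ
#1 (true ∷ σ)  = suc (#1 σ)

ℓ : ℕ → Str → ℕ
ℓ k σ = #0 σ + k * #1 σ

-- K(σ) ≥ a   (K(σ) = min{|τ| : U(τ)↓=σ}), unfolded
K≥ : Code 2 → Str → ℕ → Set
K≥ L σ a = ∀ τ → U L τ σ → a ≤ length τ

-- K^(k)(σ) ≥ a   (K^(k)(σ) = min{ℓ_k(τ) : U(τ)↓=σ}), unfolded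
K⁽_⁾≥ : ℕ → Code 2 → Str → ℕ → Set
K⁽ k ⁾≥ L σ a = ∀ τ → U L τ σ → a ≤ ℓ k τ

Seq : Set
Seq = ℕ → Bool

_↾_ : Seq → ℕ → Str
X ↾ n = applyUpTo X n

-- (k,j)-incompressible: ∃ d ∀ n, K^(k)(X↾n) ≥ ℓ_j(X↾n) − d
-- (written additively: ℓ_j(X↾n) ≤ K^(k)(X↾n) + d, avoiding truncated subtraction)
Incompressible : Code 2 → ℕ → ℕ → Seq → Set
Incompressible L k j X =
  ∃[ d ] ∀ n → ∀ τ → U L τ (X ↾ n) → ℓ j (X ↾ n) ≤ ℓ k τ + d

Unbounded : (ℕ → ℕ) → Set
Unbounded f = ∀ m → ∃[ n ] m ≤ f n

NonDecreasing : (ℕ → ℕ) → Set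
NonDecreasing f = ∀ m n → m ≤ n → f m ≤ f n

Complex : Code 2 → Seq → Set
Complex L X = ∃[ f ] (Computable f × Unbounded f × NonDecreasing f × (∀ n → K≥ L (X ↾ n) (f n)))

module Submission where

open import Defs
open import Data.Nat
  using (ℕ; zero; suc; pred; _+_; _*_; _∸_; _≤_; _<_; _≤′_; ≤′-refl; ≤′-step; _≤?_; z≤n; s≤s; s≤s⁻¹; NonZero; >-nonZero)
open import Data.Nat.Properties
open import Data.Fin using () renaming (zero to #0ᶠ; suc to sucᶠ)
open import Data.Vec using (Vec; []; _∷_)
open import Data.List using ([]; _∷_; length)
open import Data.List.Properties using (length-applyUpTo)
open import Data.Bool using (true; false)
open import Data.Product using (_,_)
open import Data.Sum using (_⊎_; inj₁; inj₂)
open import Relation.Nullary using (yes; no)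
open import Relation.Binary.PropositionalEquality
open import Function using (_∘_)

-- Idea: since every bit has ℓ_j-weight at least 1 and ℓ_k-weight at most k,
-- incompressibility gives n = |X↾n| ≤ ℓ_j(X↾n) ≤ ℓ_k(τ) + d ≤ k|τ| + d for
-- every U-description τ of X↾n, so K(X↾n) ≥ (n − d)/k.  The computable lower
-- bound is the largest m with d + k m ≤ n, computed by primitive recursion.

sg : ℕ → ℕ
sg zero    = 0
sg (suc _) = 1

sg[1+m∸n]≡1 : ∀ {m n} → n ≤ m → sg (suc m ∸ n) ≡ 1
sg[1+m∸n]≡1 {m} n≤m rewrite +-∸-assoc 1 n≤m = refl

sg[1+m∸n]≡0 : ∀ {m n} → m < n → sg (suc m ∸ n) ≡ 0
sg[1+m∸n]≡0 m<n rewrite m≤n⇒m∸n≡0 m<n = refl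

addᶜ : Code 2
addᶜ = prec (proj #0ᶠ) (comp succ (proj (sucᶠ #0ᶠ) ∷ []))

addᶜ-eval : ∀ x y → Eval addᶜ (x ∷ y ∷ []) (x + y)
addᶜ-eval zero    y = ev-prec-z ev-proj
addᶜ-eval (suc x) y = ev-prec-s (addᶜ-eval x y) (ev-comp (ev-∷ ev-proj ev-[]) ev-succ)

mulᶜ : Code 2
mulᶜ = prec zer (comp addᶜ (proj (sucᶠ (sucᶠ #0ᶠ)) ∷ proj (sucᶠ #0ᶠ) ∷ []))

mulᶜ-eval : ∀ x y → Eval mulᶜ (x ∷ y ∷ []) (x * y)
mulᶜ-eval zero    y = ev-prec-z ev-zer
mulᶜ-eval (suc x) y =
  ev-prec-s (mulᶜ-eval x y) (ev-comp (ev-∷ ev-proj (ev-∷ ev-proj ev-[])) (addᶜ-eval y (x * y)))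

predᶜ : Code 1
predᶜ = prec zer (proj #0ᶠ)

predᶜ-eval : ∀ x → Eval predᶜ (x ∷ []) (pred x)
predᶜ-eval zero    = ev-prec-z ev-zer
predᶜ-eval (suc x) = ev-prec-s (predᶜ-eval x) ev-proj

-- Arguments reversed: the recursion runs on the subtrahend.
monusᶜ : Code 2
monusᶜ = prec (proj #0ᶠ) (comp predᶜ (proj (sucᶠ #0ᶠ) ∷ []))

monusᶜ-eval : ∀ y x → Eval monusᶜ (y ∷ x ∷ []) (x ∸ y)
monusᶜ-eval zero    x = ev-prec-z ev-proj
monusᶜ-eval (suc y) x = subst (Eval monusᶜ (suc y ∷ x ∷ [])) (pred[m∸n]≡m∸[1+n] x y)
  (ev-prec-s (monusᶜ-eval y x) (ev-comp (ev-∷ ev-proj ev-[]) (predᶜ-eval (x ∸ y))))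

sgᶜ : Code 1
sgᶜ = prec zer (comp succ (zer ∷ []))

sgᶜ-eval : ∀ x → Eval sgᶜ (x ∷ []) (sg x)
sgᶜ-eval zero    = ev-prec-z ev-zer
sgᶜ-eval (suc x) = ev-prec-s (sgᶜ-eval x) (ev-comp (ev-∷ ev-zer ev-[]) ev-succ)

constᶜ : ∀ {n} → ℕ → Code n
constᶜ zero    = zer
constᶜ (suc c) = comp succ (constᶜ c ∷ [])

constᶜ-eval : ∀ {n} c (xs : Vec ℕ n) → Eval (constᶜ c) xs c
constᶜ-eval zero    xs = ev-zer
constᶜ-eval (suc c) xs = ev-comp (ev-∷ (constᶜ-eval c xs) ev-[]) ev-succ

module AffineInverse (d k : ℕ) where

  -- inverse n is the largest m with d + k m ≤ n, and 0 if there is none.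
  inverse : ℕ → ℕ
  inverse zero    = 0
  inverse (suc n) = inverse n + sg (suc (suc n) ∸ (d + k * suc (inverse n)))

  inverse-suc-≤ : ∀ n → d + k * suc (inverse n) ≤ suc n → inverse (suc n) ≡ suc (inverse n)
  inverse-suc-≤ n p = trans (cong (inverse n +_) (sg[1+m∸n]≡1 p)) (+-comm (inverse n) 1)

  inverse-suc-> : ∀ n → suc n < d + k * suc (inverse n) → inverse (suc n) ≡ inverse n
  inverse-suc-> n p = trans (cong (inverse n +_) (sg[1+m∸n]≡0 p)) (+-identityʳ (inverse n))

  inverse-sound : ∀ n → inverse n ≡ 0 ⊎ d + k * inverse n ≤ n
  inverse-sound zero = inj₁ refl
  inverse-sound (suc n) with d + k * suc (inverse n) ≤? suc n
  ... | yes p rewrite inverse-suc-≤ n p = inj₂ p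
  ... | no ¬p rewrite inverse-suc-> n (≰⇒> ¬p) with inverse-sound n
  ...   | inj₁ e = inj₁ e
  ...   | inj₂ q = inj₂ (m≤n⇒m≤1+n q)

  inverse-maximal : .{{_ : NonZero k}} → ∀ n → n < d + k * suc (inverse n)
  inverse-maximal zero = ≤-trans (m≤n*m 1 k) (m≤n+m _ d)
  inverse-maximal (suc n) with d + k * suc (inverse n) ≤? suc n
  ... | no ¬p rewrite inverse-suc-> n (≰⇒> ¬p) = ≰⇒> ¬p
  ... | yes p rewrite inverse-suc-≤ n p =
    ≤-trans (s≤s (inverse-maximal n)) (+-monoʳ-< d (*-monoʳ-< k ≤-refl))

  inverse-monotone : ∀ {m n} → m ≤ n → inverse m ≤ inverse n
  inverse-monotone = inverse-monotone′ ∘ ≤⇒≤′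
    where
    inverse-monotone′ : ∀ {m n} → m ≤′ n → inverse m ≤ inverse n
    inverse-monotone′ ≤′-refl         = ≤-refl
    inverse-monotone′ (≤′-step m≤′n) = ≤-trans (inverse-monotone′ m≤′n) (m≤m+n _ _)

  inverse-unbounded : .{{_ : NonZero k}} → ∀ m → m ≤ inverse (d + k * m)
  inverse-unbounded m =
    s≤s⁻¹ (*-cancelˡ-< k _ _ (+-cancelˡ-< d _ _ (inverse-maximal (d + k * m))))

  argumentᶜ thresholdᶜ : Code 2
  argumentᶜ  = comp succ (comp succ (proj #0ᶠ ∷ []) ∷ [])
  thresholdᶜ = comp addᶜ (constᶜ d ∷ comp mulᶜ (constᶜ k ∷ comp succ (proj (sucᶠ #0ᶠ) ∷ []) ∷ []) ∷ [])

  argumentᶜ-eval : ∀ n r → Eval argumentᶜ (n ∷ r ∷ []) (suc (suc n))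
  argumentᶜ-eval n r = ev-comp (ev-∷ (ev-comp (ev-∷ ev-proj ev-[]) ev-succ) ev-[]) ev-succ

  thresholdᶜ-eval : ∀ n r → Eval thresholdᶜ (n ∷ r ∷ []) (d + k * suc r)
  thresholdᶜ-eval n r =
    ev-comp (ev-∷ (constᶜ-eval d _)
              (ev-∷ (ev-comp (ev-∷ (constᶜ-eval k _) (ev-∷ (ev-comp (ev-∷ ev-proj ev-[]) ev-succ) ev-[]))
                             (mulᶜ-eval k (suc r)))
                    ev-[]))
            (addᶜ-eval _ _)

  inverseᶜ : Code 1
  inverseᶜ = prec zer
    (comp addᶜ (proj (sucᶠ #0ᶠ) ∷ comp sgᶜ (comp monusᶜ (thresholdᶜ ∷ argumentᶜ ∷ []) ∷ []) ∷ []))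

  inverse-computable : Computable inverse
  inverse-computable = inverseᶜ , inverseᶜ-eval
    where
    inverseᶜ-eval : ∀ n → Eval inverseᶜ (n ∷ []) (inverse n)
    inverseᶜ-eval zero    = ev-prec-z ev-zer
    inverseᶜ-eval (suc n) = ev-prec-s (inverseᶜ-eval n)
      (ev-comp (ev-∷ ev-proj
                 (ev-∷ (ev-comp (ev-∷ (ev-comp (ev-∷ (thresholdᶜ-eval n (inverse n))
                                                     (ev-∷ (argumentᶜ-eval n (inverse n)) ev-[]))
                                               (monusᶜ-eval _ _))
                                       ev-[])
                                (sgᶜ-eval _))
                       ev-[]))
               (addᶜ-eval _ _))

length≡#0+#1 : ∀ σ → length σ ≡ #0 σ + #1 σ
length≡#0+#1 []          = refl
length≡#0+#1 (false ∷ σ) = cong suc (length≡#0+#1 σ)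
length≡#0+#1 (true ∷ σ)  = trans (cong suc (length≡#0+#1 σ)) (sym (+-suc (#0 σ) (#1 σ)))

length≤ℓ : ∀ j .{{_ : NonZero j}} σ → length σ ≤ ℓ j σ
length≤ℓ j σ = begin
  length σ          ≡⟨ length≡#0+#1 σ ⟩
  #0 σ + #1 σ       ≤⟨ +-monoʳ-≤ (#0 σ) (m≤n*m (#1 σ) j) ⟩
  #0 σ + j * #1 σ   ∎
  where open ≤-Reasoning

ℓ≤*length : ∀ k .{{_ : NonZero k}} σ → ℓ k σ ≤ k * length σ
ℓ≤*length k σ = begin
  #0 σ + k * #1 σ       ≤⟨ +-monoˡ-≤ (k * #1 σ) (m≤n*m (#0 σ) k) ⟩
  k * #0 σ + k * #1 σ   ≡⟨ *-distribˡ-+ k (#0 σ) (#1 σ) ⟨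
  k * (#0 σ + #1 σ)     ≡⟨ cong (k *_) (length≡#0+#1 σ) ⟨
  k * length σ          ∎
  where open ≤-Reasoning

ℓ≤ℓ+d⇒length≤d+*length : ∀ j k .{{_ : NonZero j}} .{{_ : NonZero k}} d σ τ →
                        ℓ j σ ≤ ℓ k τ + d → length σ ≤ d + k * length τ
ℓ≤ℓ+d⇒length≤d+*length j k d σ τ ℓσ≤ℓτ+d = begin
  length σ            ≤⟨ length≤ℓ j σ ⟩
  ℓ j σ               ≤⟨ ℓσ≤ℓτ+d ⟩
  ℓ k τ + d           ≤⟨ +-monoˡ-≤ d (ℓ≤*length k τ) ⟩
  k * length τ + d    ≡⟨ +-comm (k * length τ) d ⟩
  d + k * length τ    ∎
  where open ≤-Reasoning

mainTheorem5 : (j k : ℕ) → 1 ≤ j → 1 ≤ k → j ≤ k →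
               (L : Code 2) → IsPFListing L →
               (X : Seq) → Incompressible L k j X → Complex L X
mainTheorem5 j k 1≤j 1≤k _ L _ X (d , incompressible) =
  inverse , inverse-computable , (λ m → d + k * m , inverse-unbounded m) ,
  (λ _ _ → inverse-monotone) , K≥inverse
  where
  open AffineInverse d k
  instance
    j≢0 : NonZero j
    j≢0 = >-nonZero 1≤j
    k≢0 : NonZero k
    k≢0 = >-nonZero 1≤k

  K≥inverse : ∀ n → K≥ L (X ↾ n) (inverse n)
  K≥inverse n τ Uτ with inverse-sound n
  ... | inj₁ inverse≡0 rewrite inverse≡0 = z≤n
  ... | inj₂ d+k*inverse≤n = *-cancelˡ-≤ k (+-cancelˡ-≤ d _ _ (≤-trans d+k*inverse≤n n≤d+k*|τ|))
    where
    n≤d+k*|τ| : n ≤ d + k * length τ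
    n≤d+k*|τ| = subst (_≤ d + k * length τ) (length-applyUpTo X n)
      (ℓ≤ℓ+d⇒length≤d+*length j k d (X ↾ n) τ (incompressible n τ Uτ))
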